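{- Let $f\colon\vec R\to\vec S$ be a bijective homomorphism of separation systems. If $R$ is nested and $\vec S$ is regular, then $\vec R$ and $\vec S$ are tree sets and $f$ is an isomorphism of tree sets.
   Context: A separation system $(\vec S,\le,{}^*)$ is a poset with an order-reversing involution $\vec s\mapsto\overleftarrow s$; $s=\{\vec s,\overleftarrow s\}$ is the unoriented separation and $S$ the set of these. $\vec s$ is degenerate if $\vec s=\overleftarrow s$, small if $\vec s\le\overleftarrow s$; a separation system is regular if it has no small element. Unoriented $r,s$ are nested if some orientation of $r$ is $\le$ some orientation of $s$; $R$ is nested if any two of its separations are nested. $\vec r$ is trivial if there is $s$ with $\vec r<\vec s$ and $\vec r<\overleftarrow s$ (strictly). A tree set is a nested separation system with no degenerate and no trivial elements. A homomorphism $f\colon\vec R\to\vec S$ satisfies $f(\overleftarrow r)=(f(\vec r))^*$ for all $\vec r$ and $f(\vec r_1)\le f(\vec r_2)$ whenever $\vec r_1\le\vec r_2$; an isomorphism is a bijective homomorphism whose inverse is a homomorphism. -}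

module Defs where

open import Level using (Level; _⊔_; suc)
open import Data.Product using (Σ; ∃; _×_; _,_)
open import Data.Sum using (_⊎_)
open import Relation.Nullary using (¬_)
open import Relation.Binary.Core using (Rel)
open import Relation.Binary.Structures using (IsPartialOrder)
open import Relation.Binary.PropositionalEquality using (_≡_)
open import Function.Definitions using (Bijective; Inverseˡ; Inverseʳ)

record SepSys (a ℓ : Level) : Set (suc (a ⊔ ℓ)) where
  infix 4 _≤_
  infix 10 _*
  field
    Carrier        : Set a
    _≤_            : Rel Carrier ℓ
    isPartialOrder : IsPartialOrder _≡_ _≤_
    _*             : Carrier → Carrier
    involutive     : ∀ s → (s *) * ≡ s
    order-reversing : ∀ {r s} → r ≤ s → (s *) ≤ (r *)

  infix 4 _<_
  _<_ : Rel Carrier (a ⊔ ℓ)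
  r < s = (r ≤ s) × ¬ (r ≡ s)

  -- the two orientations of the unoriented separation {s, s*}
  IsOrientationOf : Carrier → Carrier → Set a
  IsOrientationOf t s = (t ≡ s) ⊎ (t ≡ s *)

  Degenerate : Carrier → Set a
  Degenerate s = s ≡ s *

  Small : Carrier → Set ℓ
  Small s = s ≤ s *

  Regular : Set (a ⊔ ℓ)
  Regular = ∀ s → ¬ Small s

  NestedPair : Carrier → Carrier → Set (a ⊔ ℓ)
  NestedPair r s = Σ Carrier λ r' → Σ Carrier λ s' →
    IsOrientationOf r' r × IsOrientationOf s' s × r' ≤ s'

  Nested : Set (a ⊔ ℓ)
  Nested = ∀ r s → NestedPair r s

  Trivial : Carrier → Set (a ⊔ ℓ)
  Trivial r = Σ Carrier λ s → (r < s) × (r < s *)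

  IsTreeSet : Set (a ⊔ ℓ)
  IsTreeSet = Nested × (∀ s → ¬ Degenerate s) × (∀ s → ¬ Trivial s)

open SepSys

IsHom : ∀ {a ℓ b m} (R : SepSys a ℓ) (S : SepSys b m) →
        (Carrier R → Carrier S) → Set (a ⊔ ℓ ⊔ b ⊔ m)
IsHom R S f =
  (∀ r → f ((_*) R r) ≡ (_*) S (f r)) ×
  (∀ {r₁ r₂} → _≤_ R r₁ r₂ → _≤_ S (f r₁) (f r₂))

IsIso : ∀ {a ℓ b m} (R : SepSys a ℓ) (S : SepSys b m) →
        (Carrier R → Carrier S) → Set (a ⊔ ℓ ⊔ b ⊔ m)
IsIso R S f =
  IsHom R S f ×
  Σ (Carrier S → Carrier R) λ g →
    Inverseˡ _≡_ _≡_ f g × Inverseʳ _≡_ _≡_ f g × IsHom S R g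

module Submission where

-- The proof rests on one observation about regular
-- systems: no separation lies below both orientations of another one, and
-- none lies above both (either would produce a small separation).
--
--  * A regular system has no degenerate and no trivial elements, so a
--    regular nested system is a tree set.
--  * A homomorphism maps small elements to small ones, so R is regular
--    because S is; hence R is a tree set.
--  * A homomorphism maps nested pairs to nested pairs, so the surjective f
--    carries the nestedness of R over to S; hence S is a tree set.
--  * An injective homomorphism out of a nested system into a regular one
--    reflects the order: of the four ways in which r₁, r₂ can be nested,
--    two contradict regularity of S and the other two give r₁ ≤ r₂.
--    Therefore the inverse of f is again a homomorphism, and f is an
--    isomorphism.

open import Defs
open import Data.Product using (_×_; _,_; proj₁; proj₂)
open import Data.Sum using (inj₁; inj₂)
open import Relation.Nullary using (¬_)
open import Relation.Binary.PropositionalEquality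
  using (_≡_; refl; sym; cong; subst; subst₂; module ≡-Reasoning)
open import Relation.Binary.Structures using (IsPartialOrder)
open import Function.Definitions
  using (Injective; Bijective; StrictlySurjective; StrictlyInverseˡ; StrictlyInverseʳ)
open import Function.Consequences.Propositional
  using (surjective⇒strictlySurjective; strictlyInverseˡ⇒inverseˡ; strictlyInverseʳ⇒inverseʳ)

module _ {a ℓ} (S : SepSys a ℓ) where
  open SepSys S
  open IsPartialOrder isPartialOrder using () renaming (refl to ≤-refl; trans to ≤-trans)

  ≤*⇒≤* : ∀ {r s} → r ≤ s * → s ≤ r *
  ≤*⇒≤* {r} {s} r≤s* = subst (_≤ r *) (involutive s) (order-reversing r≤s*)

  *≤⇒*≤ : ∀ {r s} → r * ≤ s → s * ≤ r
  *≤⇒*≤ {r} {s} r*≤s = subst (s * ≤_) (involutive r) (order-reversing r*≤s)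

  *≤*⇒≥ : ∀ {r s} → r * ≤ s * → s ≤ r
  *≤*⇒≥ {r} r*≤s* = subst (_ ≤_) (involutive r) (≤*⇒≤* r*≤s*)

  below-both⇒small : ∀ {r s} → r ≤ s → r ≤ s * → Small r
  below-both⇒small r≤s r≤s* = ≤-trans r≤s (≤*⇒≤* r≤s*)

  above-both⇒small : ∀ {r s} → r ≤ s → r * ≤ s → Small (s *)
  above-both⇒small r≤s r*≤s = below-both⇒small (*≤⇒*≤ r*≤s) (order-reversing r≤s)

  regular⇒nondegenerate : Regular → ∀ s → ¬ Degenerate s
  regular⇒nondegenerate regular s s≡s* = regular s (subst (s ≤_) s≡s* ≤-refl)

  regular⇒nontrivial : Regular → ∀ r → ¬ Trivial r
  regular⇒nontrivial regular r (s , (r≤s , _) , (r≤s* , _)) =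
    regular r (below-both⇒small r≤s r≤s*)

  regular-nested⇒treeSet : Regular → Nested → IsTreeSet
  regular-nested⇒treeSet regular nested =
    nested , regular⇒nondegenerate regular , regular⇒nontrivial regular

module _ {a ℓ b m} (R : SepSys a ℓ) (S : SepSys b m)
         {f : SepSys.Carrier R → SepSys.Carrier S} (hom : IsHom R S f) where
  private
    module R = SepSys R
    module S = SepSys S

    f-* : ∀ r → f (r R.*) ≡ f r S.*
    f-* = proj₁ hom

    f-mono : ∀ {r₁ r₂} → r₁ R.≤ r₂ → f r₁ S.≤ f r₂
    f-mono = proj₂ hom

  hom-preserves-small : ∀ {r} → R.Small r → S.Small (f r)
  hom-preserves-small {r} small = subst (f r S.≤_) (f-* r) (f-mono small)

  hom-reflects-regular : S.Regular → R.Regular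
  hom-reflects-regular regular r small = regular (f r) (hom-preserves-small small)

  hom-preserves-orientation : ∀ {t r} → R.IsOrientationOf t r → S.IsOrientationOf (f t) (f r)
  hom-preserves-orientation (inj₁ refl) = inj₁ refl
  hom-preserves-orientation (inj₂ refl) = inj₂ (f-* _)

  hom-preserves-nestedPair : ∀ {r s} → R.NestedPair r s → S.NestedPair (f r) (f s)
  hom-preserves-nestedPair (r' , s' , r'∼r , s'∼s , r'≤s') =
    f r' , f s' , hom-preserves-orientation r'∼r , hom-preserves-orientation s'∼s , f-mono r'≤s'

  surjective-hom-preserves-nested : StrictlySurjective _≡_ f → R.Nested → S.Nested
  surjective-hom-preserves-nested surjective nested s t
    with surjective s | surjective t
  ... | r , refl | u , refl = hom-preserves-nestedPair (nested r u)

  hom-reflects-order : Injective _≡_ _≡_ f → R.Nested → S.Regular →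
                       ∀ {r₁ r₂} → f r₁ S.≤ f r₂ → r₁ R.≤ r₂
  hom-reflects-order injective nested regular {r₁} {r₂} fr₁≤fr₂ = from-nested (nested r₁ r₂)
    where
    absurd : ∀ {s} → S.Small s → r₁ R.≤ r₂
    absurd {s} small with () ← regular s small

    from-nested : R.NestedPair r₁ r₂ → r₁ R.≤ r₂
    from-nested (_ , _ , inj₁ refl , inj₁ refl , r₁≤r₂) = r₁≤r₂
    from-nested (_ , _ , inj₁ refl , inj₂ refl , r₁≤r₂*) =
      absurd (below-both⇒small S fr₁≤fr₂ (subst (f r₁ S.≤_) (f-* r₂) (f-mono r₁≤r₂*)))
    from-nested (_ , _ , inj₂ refl , inj₁ refl , r₁*≤r₂) =
      absurd (above-both⇒small S fr₁≤fr₂ (subst (S._≤ f r₂) (f-* r₁) (f-mono r₁*≤r₂)))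
    from-nested (_ , _ , inj₂ refl , inj₂ refl , r₁*≤r₂*) =
      subst (R._≤ r₂) (injective fr₂≡fr₁) (IsPartialOrder.refl R.isPartialOrder)
      where
      fr₂≡fr₁ : f r₂ ≡ f r₁
      fr₂≡fr₁ = IsPartialOrder.antisym S.isPartialOrder
                  (f-mono (*≤*⇒≥ R r₁*≤r₂*))
                  fr₁≤fr₂

  inverse-of-order-embedding-isHom :
    (∀ {r₁ r₂} → f r₁ S.≤ f r₂ → r₁ R.≤ r₂) →
    ∀ {g} → StrictlyInverseˡ _≡_ f g → StrictlyInverseʳ _≡_ f g → IsHom S R g
  inverse-of-order-embedding-isHom reflects {g} fg≡id gf≡id = g-* , g-mono
    where
    g-* : ∀ s → g (s S.*) ≡ g s R.*
    g-* s = begin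
      g (s S.*)         ≡⟨ cong (λ t → g (t S.*)) (sym (fg≡id s)) ⟩
      g (f (g s) S.*)   ≡⟨ cong g (sym (f-* (g s))) ⟩
      g (f (g s R.*))   ≡⟨ gf≡id (g s R.*) ⟩
      g s R.*           ∎
      where open ≡-Reasoning

    g-mono : ∀ {s₁ s₂} → s₁ S.≤ s₂ → g s₁ R.≤ g s₂
    g-mono {s₁} {s₂} s₁≤s₂ = reflects (subst₂ S._≤_ (sym (fg≡id s₁)) (sym (fg≡id s₂)) s₁≤s₂)

lemma2p4 : ∀ {a ℓ b m} (R : SepSys a ℓ) (S : SepSys b m)
           (f : SepSys.Carrier R → SepSys.Carrier S) →
           IsHom R S f → Bijective _≡_ _≡_ f →
           SepSys.Nested R → SepSys.Regular S →
           SepSys.IsTreeSet R × SepSys.IsTreeSet S × IsIso R S f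
lemma2p4 R S f hom (injective , surjective) nestedR regularS =
  regular-nested⇒treeSet R regularR nestedR ,
  regular-nested⇒treeSet S regularS nestedS ,
  hom , g , strictlyInverseˡ⇒inverseˡ f fg≡id , strictlyInverseʳ⇒inverseʳ f gf≡id ,
  inverse-of-order-embedding-isHom R S hom
    (hom-reflects-order R S hom injective nestedR regularS) fg≡id gf≡id
  where
  onto : StrictlySurjective _≡_ f
  onto = surjective⇒strictlySurjective surjective

  g : SepSys.Carrier S → SepSys.Carrier R
  g s = proj₁ (onto s)

  fg≡id : StrictlyInverseˡ _≡_ f g
  fg≡id s = proj₂ (onto s)

  gf≡id : StrictlyInverseʳ _≡_ f g
  gf≡id r = injective (fg≡id (f r))

  regularR : SepSys.Regular R
  regularR = hom-reflects-regular R S hom regularS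

  nestedS : SepSys.Nested S
  nestedS = surjective-hom-preserves-nested R S hom onto nestedR
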